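{- Let $s,d,k,q$ be positive integers with $q\geq s$ and $d\mid (q-s)$. Define $t_i=q$ if $d\mid i$ and $t_i=s$ if $d\nmid i$, for $1\leq i\leq k$. Then $$C_k(t_1,\dots,t_k)\leq \left(s+k+\frac{q-s}{d}-1\right)_k.$$
   Context: For a permutation $\tau$ of $\{1,\dots,k\}$, its type is $(c_1,\dots,c_k)$ where $c_i$ is the number of cycles of length $i$ in its disjoint cycle decomposition; $N(c_1,\dots,c_k)=\frac{k!}{1^{c_1}c_1!\,2^{c_2}c_2!\cdots k^{c_k}c_k!}$ is the number of permutations in $S_k$ of type $(c_1,\dots,c_k)$. The polynomial $C_k(t_1,\dots,t_k)=\sum_{c_1+2c_2+\cdots+kc_k=k}N(c_1,\dots,c_k)\,t_1^{c_1}\cdots t_k^{c_k}$, the sum over nonnegative integer tuples. For real $t$, $(t)_k=t(t-1)\cdots(t-k+1)$. -}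

module Defs where

open import Data.Nat using (ℕ; zero; suc; _+_; _*_; _∸_; _^_; _≟_; NonZero; _!)
open import Data.Nat.Properties using (m*n≢0; m^n≢0; _!≢0)
open import Data.Nat.DivMod using (_/_)
open import Data.Nat.Divisibility using (_∣?_)
open import Data.List using (List; []; _∷_; [_]; map; concatMap; upTo; filter)
open import Data.Nat.ListAction using (sum)
open import Data.Vec using (Vec; []; _∷_)
open import Relation.Nullary.Decidable using (does)
open import Data.Bool using (if_then_else_)

allVecs : (m b : ℕ) → List (Vec ℕ m)
allVecs zero    b = [ [] ]
allVecs (suc m) b = concatMap (λ x → map (x ∷_) (allVecs m b)) (upTo (suc b))

-- A vector (c_{i}, c_{i+1}, …) whose first entry counts cycles of length i.
-- weightFrom i c = i c_i + (i+1) c_{i+1} + …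
weightFrom : ∀ {m} → ℕ → Vec ℕ m → ℕ
weightFrom i []       = 0
weightFrom i (c ∷ cs) = i * c + weightFrom (suc i) cs

-- Cycle types of S_k: tuples (c_1,…,c_k) of naturals with Σ i c_i = k.
-- (Each c_i ≤ k necessarily, so enumerating entries in {0,…,k} is exhaustive.)
cycleTypes : (k : ℕ) → List (Vec ℕ k)
cycleTypes k = filter (λ c → weightFrom 1 c ≟ k) (allVecs k k)

-- denomFrom i c = Π_j (i+1+j)^{c_j} c_j!   (first entry = cycles of length suc i)
denomFrom : ∀ {m} → ℕ → Vec ℕ m → ℕ
denomFrom i []       = 1
denomFrom i (c ∷ cs) = (suc i ^ c * c !) * denomFrom (suc i) cs

denomFrom-nonZero : ∀ {m} i (c : Vec ℕ m) → NonZero (denomFrom i c)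
denomFrom-nonZero i []       = _
denomFrom-nonZero i (c ∷ cs) =
  m*n≢0 (suc i ^ c * c !) (denomFrom (suc i) cs)
    {{m*n≢0 (suc i ^ c) (c !) {{m^n≢0 (suc i) c}} {{c !≢0}}}}
    {{denomFrom-nonZero (suc i) cs}}

-- N(c_1,…,c_k) = k! / (1^{c_1} c_1! 2^{c_2} c_2! ⋯ k^{c_k} c_k!)  (exact division)
N : ∀ {k} → Vec ℕ k → ℕ
N {k} c = (k ! / denomFrom 0 c) {{denomFrom-nonZero 0 c}}

monoFrom : ∀ {m} → (ℕ → ℕ) → ℕ → Vec ℕ m → ℕ
monoFrom t i []       = 1
monoFrom t i (c ∷ cs) = t i ^ c * monoFrom t (suc i) cs

C : (k : ℕ) → (ℕ → ℕ) → ℕ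
C k t = sum (map (λ c → N c * monoFrom t 1 c) (cycleTypes k))

fallingFactorial : ℕ → ℕ → ℕ
fallingFactorial x zero    = 1
fallingFactorial x (suc k) = fallingFactorial x k * (x ∸ k)

tSeq : (s d q : ℕ) → ℕ → ℕ
tSeq s d q i = if does (d ∣? i) then q else s

module Submission where

-- Write t = tSeq s d q and q = s + m·d, where m = (q − s) / d.  By the exponential
-- formula C_k(t) / k! is the coefficient of Xᵏ in exp (Σᵢ tᵢ Xⁱ / i), and since tᵢ = s + d m [d ∣ i]
-- this series is (1 − X)^(−s) · (1 − X^d)^(−m).  Coefficientwise (1 − X^d)^(−m) ≤ (1 − X)^(−m), hence
-- C_k(t) ≤ k! [Xᵏ] (1 − X)^(−(s+m)) = (s + m + k − 1)ₖ.
--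
-- A series A is "exp of
-- Σ wᵢ Xⁱ / i" when n·Aₙ = Σ_{1≤i≤n} wᵢ A_{n−i} (ExpRec); such a series is determined by A₀, and by
-- the product rule for θ = X·d/dX the Cauchy product of two solutions solves the recurrence for the
-- summed weights.

module GeneratingSeries where

  open import Defs
  open import Algebra.Bundles using (Ring)
  open import Data.Bool using (true; false; if_then_else_)
  open import Data.Empty using (⊥-elim)
  open import Data.List using (List; []; _∷_; _++_; map; concatMap; applyUpTo; upTo; filter)
  open import Data.Nat as ℕ using (ℕ; zero; suc; _∸_; _!; _^_; _≡ᵇ_; _<ᵇ_; z≤n; s≤s)
  import Data.Nat.Properties as ℕ
  open import Data.Nat.DivMod using (_/_; m*n/n≡m; m/n*n≤m)
  open import Data.Nat.Divisibility
    using (_∣_; _∣?_; divides; ∣-refl; n∣m*n; >⇒∤; ∣m∣n⇒∣m+n; ∣m+n∣m⇒∣n; ∣m∸n∣n⇒∣m)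
  open import Data.Nat.ListAction using (sum)
  open import Data.Nat.Tactic.RingSolver using (solve-∀)
  open import Data.Rational as ℚ using (ℚ; 0ℚ; 1ℚ; _+_; _*_; _≤_; _<_; 1/_)
  import Data.Rational.Properties as ℚ
  open import Data.Rational.Solver using (module +-*-Solver)
  open import Data.Sum using (inj₁; inj₂)
  open import Data.Vec using (Vec; []; _∷_)
  open import Relation.Binary.Definitions using (tri<; tri≈; tri>)
  open import Relation.Binary.PropositionalEquality
  open import Relation.Nullary using (¬_; yes; no; does)
  open import Relation.Nullary.Decidable using (dec-true; dec-false)
  open import Relation.Nullary.Reflects using (Reflects; ofʸ; ofⁿ; fromEquivalence; det)
  open import Algebra.Properties.CommutativeSemigroup ℕ.+-commutativeSemigroup
    using () renaming (xy∙z≈xz∙y to +-rightComm)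
  open import Algebra.Properties.Semiring.Mult (Ring.semiring ℚ.+-*-ring)
    using (_×_; ×-homo-+; ×1-homo-*)
  open +-*-Solver using (solve; _:+_; _:*_; _:=_)
  open ≡-Reasoning
  module ≤ = ℚ.≤-Reasoning

  ι : ℕ → ℚ
  ι n = n × 1ℚ

  ι-+ : ∀ a b → ι (a ℕ.+ b) ≡ ι a + ι b
  ι-+ a b = ×-homo-+ 1ℚ a b

  ι-* : ∀ a b → ι (a ℕ.* b) ≡ ι a * ι b
  ι-* = ×1-homo-*

  ι-∸ : ∀ {a b} → a ℕ.≤ b → ι b ≡ ι a + ι (b ∸ a)
  ι-∸ {a} {b} a≤b = trans (cong ι (sym (ℕ.m+[n∸m]≡n a≤b))) (ι-+ a (b ∸ a))

  ι-nonneg : ∀ n → 0ℚ ≤ ι n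
  ι-nonneg zero    = ℚ.≤-refl
  ι-nonneg (suc n) = ℚ.+-mono-≤ (ℚ.<⇒≤ (ℚ.positive⁻¹ 1ℚ)) (ι-nonneg n)

  ι-pos : ∀ n → 0ℚ < ι (suc n)
  ι-pos n = ℚ.+-mono-<-≤ (ℚ.positive⁻¹ 1ℚ) (ι-nonneg n)

  ι-mono : ∀ {a b} → a ℕ.≤ b → ι a ≤ ι b
  ι-mono {b = b} z≤n = ι-nonneg b
  ι-mono (s≤s a≤b)   = ℚ.+-monoʳ-≤ 1ℚ (ι-mono a≤b)

  ι-reflect : ∀ {a b} → ι a ≤ ι b → a ℕ.≤ b
  ι-reflect {a} {b} ιa≤ιb with a ℕ.≤? b
  ... | yes a≤b = a≤b
  ... | no  a≰b = ⊥-elim (ℚ.<-irrefl refl (ℚ.<-≤-trans ιb<ιsb (ℚ.≤-trans (ι-mono (ℕ.≰⇒> a≰b)) ιa≤ιb)))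
    where
    ιb<ιsb : ι b < ι (suc b)
    ιb<ιsb = ℚ.≤-<-trans (ℚ.≤-reflexive (sym (ℚ.+-identityˡ (ι b)))) (ℚ.+-monoˡ-< (ι b) (ℚ.positive⁻¹ 1ℚ))

  ι⁻¹ : (n : ℕ) → .{{ℕ.NonZero n}} → ℚ
  ι⁻¹ (suc n) = (1/ ι (suc n)) {{ℚ.pos⇒nonZero (ι (suc n)) {{ℚ.positive (ι-pos n)}}}}

  ι-inverse : ∀ n .{{_ : ℕ.NonZero n}} → ι n * ι⁻¹ n ≡ 1ℚ
  ι-inverse (suc n) = ℚ.*-inverseʳ (ι (suc n)) {{ℚ.pos⇒nonZero (ι (suc n)) {{ℚ.positive (ι-pos n)}}}}

  ι⁻¹-nonneg : ∀ n .{{_ : ℕ.NonZero n}} → 0ℚ ≤ ι⁻¹ n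
  ι⁻¹-nonneg (suc n) =
    ℚ.<⇒≤ (ℚ.positive⁻¹ _ {{ℚ.1/pos⇒pos (ι (suc n)) {{ℚ.positive (ι-pos n)}}}})

  ι-cancelˡ : ∀ n {x y} → ι (suc n) * x ≡ ι (suc n) * y → x ≡ y
  ι-cancelˡ n {x} {y} eq = begin
    x                                ≡⟨ undo x ⟩
    ι⁻¹ (suc n) * (ι (suc n) * x)    ≡⟨ cong (ι⁻¹ (suc n) *_) eq ⟩
    ι⁻¹ (suc n) * (ι (suc n) * y)    ≡⟨ undo y ⟨
    y                                ∎
    where
    undo : ∀ z → z ≡ ι⁻¹ (suc n) * (ι (suc n) * z)
    undo z = sym (begin
      ι⁻¹ (suc n) * (ι (suc n) * z)  ≡⟨ solve 3 (λ a b c → a :* (b :* c) := (b :* a) :* c) refl (ι⁻¹ (suc n)) (ι (suc n)) z ⟩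
      (ι (suc n) * ι⁻¹ (suc n)) * z  ≡⟨ cong (_* z) (ι-inverse (suc n)) ⟩
      1ℚ * z                         ≡⟨ ℚ.*-identityˡ z ⟩
      z                              ∎)

  *-nonneg : ∀ {x y} → 0ℚ ≤ x → 0ℚ ≤ y → 0ℚ ≤ x * y
  *-nonneg {x} {y} 0≤x 0≤y =
    ℚ.nonNegative⁻¹ (x * y) {{ℚ.nonNeg*nonNeg⇒nonNeg x {{ℚ.nonNegative 0≤x}} y {{ℚ.nonNegative 0≤y}}}}

  ∑ : ℕ → (ℕ → ℚ) → ℚ
  ∑ zero    f = 0ℚ
  ∑ (suc n) f = ∑ n f + f n

  ∑-cong : ∀ n {f g} → (∀ i → i ℕ.< n → f i ≡ g i) → ∑ n f ≡ ∑ n g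
  ∑-cong zero    f≗g = refl
  ∑-cong (suc n) f≗g = cong₂ _+_ (∑-cong n (λ i i<n → f≗g i (ℕ.m≤n⇒m≤1+n i<n))) (f≗g n ℕ.≤-refl)

  ∑-zero : ∀ n {f} → (∀ i → i ℕ.< n → f i ≡ 0ℚ) → ∑ n f ≡ 0ℚ
  ∑-zero zero    f≗0 = refl
  ∑-zero (suc n) {f} f≗0 = begin
    ∑ n f + f n  ≡⟨ cong₂ _+_ (∑-zero n (λ i i<n → f≗0 i (ℕ.m≤n⇒m≤1+n i<n))) (f≗0 n ℕ.≤-refl) ⟩
    0ℚ + 0ℚ      ≡⟨ ℚ.+-identityˡ 0ℚ ⟩
    0ℚ           ∎

  ∑-+ : ∀ n f g → ∑ n (λ i → f i + g i) ≡ ∑ n f + ∑ n g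
  ∑-+ zero    f g = sym (ℚ.+-identityˡ 0ℚ)
  ∑-+ (suc n) f g = trans (cong (_+ (f n + g n)) (∑-+ n f g))
    (solve 4 (λ a b c d → (a :+ b) :+ (c :+ d) := (a :+ c) :+ (b :+ d)) refl (∑ n f) (∑ n g) (f n) (g n))

  ∑-*ˡ : ∀ n c f → ∑ n (λ i → c * f i) ≡ c * ∑ n f
  ∑-*ˡ zero    c f = sym (ℚ.*-zeroʳ c)
  ∑-*ˡ (suc n) c f = trans (cong (_+ c * f n) (∑-*ˡ n c f)) (sym (ℚ.*-distribˡ-+ c (∑ n f) (f n)))

  ∑-*ʳ : ∀ n f c → ∑ n (λ i → f i * c) ≡ ∑ n f * c
  ∑-*ʳ n f c = begin
    ∑ n (λ i → f i * c)  ≡⟨ ∑-cong n (λ i _ → ℚ.*-comm (f i) c) ⟩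
    ∑ n (λ i → c * f i)  ≡⟨ ∑-*ˡ n c f ⟩
    c * ∑ n f            ≡⟨ ℚ.*-comm c (∑ n f) ⟩
    ∑ n f * c            ∎

  ∑-mono : ∀ n {f g} → (∀ i → i ℕ.< n → f i ≤ g i) → ∑ n f ≤ ∑ n g
  ∑-mono zero    f≤g = ℚ.≤-refl
  ∑-mono (suc n) f≤g = ℚ.+-mono-≤ (∑-mono n (λ i i<n → f≤g i (ℕ.m≤n⇒m≤1+n i<n))) (f≤g n ℕ.≤-refl)

  ∑-head : ∀ n f → ∑ (suc n) f ≡ f 0 + ∑ n (λ i → f (suc i))
  ∑-head zero    f = trans (ℚ.+-identityˡ (f 0)) (sym (ℚ.+-identityʳ (f 0)))
  ∑-head (suc n) f = trans (cong (_+ f (suc n)) (∑-head n f)) (ℚ.+-assoc (f 0) _ _)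

  ∑-split : ∀ a b f → ∑ (a ℕ.+ b) f ≡ ∑ a f + ∑ b (λ i → f (a ℕ.+ i))
  ∑-split a zero    f = trans (cong (λ n → ∑ n f) (ℕ.+-identityʳ a)) (sym (ℚ.+-identityʳ (∑ a f)))
  ∑-split a (suc b) f = begin
    ∑ (a ℕ.+ suc b) f                                  ≡⟨ cong (λ n → ∑ n f) (ℕ.+-suc a b) ⟩
    ∑ (a ℕ.+ b) f + f (a ℕ.+ b)                        ≡⟨ cong (_+ f (a ℕ.+ b)) (∑-split a b f) ⟩
    (∑ a f + ∑ b (λ i → f (a ℕ.+ i))) + f (a ℕ.+ b)    ≡⟨ ℚ.+-assoc (∑ a f) _ _ ⟩
    ∑ a f + ∑ (suc b) (λ i → f (a ℕ.+ i))              ∎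

  ∑-reverse : ∀ n f → ∑ n f ≡ ∑ n (λ i → f (n ∸ suc i))
  ∑-reverse zero    f = refl
  ∑-reverse (suc n) f = begin
    ∑ n f + f n                          ≡⟨ cong (_+ f n) (∑-reverse n f) ⟩
    ∑ n (λ i → f (n ∸ suc i)) + f n      ≡⟨ ℚ.+-comm _ (f n) ⟩
    f n + ∑ n (λ i → f (n ∸ suc i))      ≡⟨ ∑-head n (λ i → f (n ∸ i)) ⟨
    ∑ (suc n) (λ i → f (n ∸ i))          ∎

  ∑-swap : ∀ a b (h : ℕ → ℕ → ℚ) → ∑ a (λ i → ∑ b (h i)) ≡ ∑ b (λ j → ∑ a (λ i → h i j))
  ∑-swap zero    b h = sym (∑-zero b (λ _ _ → refl))
  ∑-swap (suc a) b h = begin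
    ∑ a (λ i → ∑ b (h i)) + ∑ b (h a)              ≡⟨ cong (_+ ∑ b (h a)) (∑-swap a b h) ⟩
    ∑ b (λ j → ∑ a (λ i → h i j)) + ∑ b (h a)      ≡⟨ ∑-+ b (λ j → ∑ a (λ i → h i j)) (h a) ⟨
    ∑ b (λ j → ∑ (suc a) (λ i → h i j))            ∎

  ∑-triangle : ∀ n (h : ℕ → ℕ → ℚ) →
               ∑ n (λ i → ∑ (suc i) (λ j → h j i)) ≡ ∑ n (λ j → ∑ (n ∸ j) (λ l → h j (j ℕ.+ l)))
  ∑-triangle zero    h = refl
  ∑-triangle (suc n) h = begin
    ∑ n (λ i → ∑ (suc i) (λ j → h j i)) + diagonal  ≡⟨ cong (_+ diagonal) (∑-triangle n h) ⟩
    ∑ n column + diagonal                           ≡⟨ cong (_+ diagonal) lastColumnEmpty ⟨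
    ∑ (suc n) column + diagonal                     ≡⟨ ∑-+ (suc n) column (λ j → h j n) ⟨
    ∑ (suc n) (λ j → column j + h j n)              ≡⟨ ∑-cong (suc n) extend ⟩
    ∑ (suc n) (λ j → ∑ (suc n ∸ j) (λ l → h j (j ℕ.+ l)))  ∎
    where
    diagonal = ∑ (suc n) (λ j → h j n)
    column : ℕ → ℚ
    column j = ∑ (n ∸ j) (λ l → h j (j ℕ.+ l))
    lastColumnEmpty : ∑ (suc n) column ≡ ∑ n column
    lastColumnEmpty = trans (cong (λ m → ∑ n column + ∑ m (λ l → h n (n ℕ.+ l))) (ℕ.n∸n≡0 n))
                            (ℚ.+-identityʳ (∑ n column))
    extend : ∀ j → j ℕ.< suc n → column j + h j n ≡ ∑ (suc n ∸ j) (λ l → h j (j ℕ.+ l))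
    extend j j<sn = sym (begin
      ∑ (suc n ∸ j) (λ l → h j (j ℕ.+ l))   ≡⟨ cong (λ m → ∑ m (λ l → h j (j ℕ.+ l))) (ℕ.+-∸-assoc 1 j≤n) ⟩
      column j + h j (j ℕ.+ (n ∸ j))        ≡⟨ cong (λ i → column j + h j i) (ℕ.m+[n∸m]≡n j≤n) ⟩
      column j + h j n                      ∎)
      where j≤n = ℕ.≤-pred j<sn

  ≡ᵇ-true : ∀ {a b} → a ≡ b → (a ≡ᵇ b) ≡ true
  ≡ᵇ-true {a} {b} = dec-true (a ℕ.≟ b)

  ≡ᵇ-false : ∀ {a b} → a ≢ b → (a ≡ᵇ b) ≡ false
  ≡ᵇ-false {a} {b} = dec-false (a ℕ.≟ b)

  <ᵇ-true : ∀ {a b} → a ℕ.< b → (a <ᵇ b) ≡ true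
  <ᵇ-true {a} {b} = dec-true (a ℕ.<? b)

  <ᵇ-false : ∀ {a b} → ¬ a ℕ.< b → (a <ᵇ b) ≡ false
  <ᵇ-false {a} {b} = dec-false (a ℕ.<? b)

  ≡ᵇ-reflects : ∀ a b → Reflects (a ≡ b) (a ≡ᵇ b)
  ≡ᵇ-reflects a b = fromEquivalence (ℕ.≡ᵇ⇒≡ a b) (ℕ.≡⇒≡ᵇ a b)

  ∑-delta : ∀ n a (g : ℕ → ℚ) → ∑ n (λ i → if a ≡ᵇ i then g i else 0ℚ) ≡ (if a <ᵇ n then g a else 0ℚ)
  ∑-delta zero    a g = refl
  ∑-delta (suc n) a g with ℕ.<-cmp a n
  ... | tri< a<n a≢n _ rewrite ∑-delta n a g | <ᵇ-true a<n | ≡ᵇ-false a≢n | <ᵇ-true (ℕ.m<n⇒m<1+n a<n) =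
    ℚ.+-identityʳ (g a)
  ... | tri≈ _ refl _ rewrite ∑-delta n a g | <ᵇ-false (ℕ.n≮n a) | ≡ᵇ-true (refl {x = a}) | <ᵇ-true (ℕ.n<1+n a) =
    ℚ.+-identityˡ (g a)
  ... | tri> _ a≢n n<a rewrite ∑-delta n a g | <ᵇ-false (ℕ.<⇒≯ n<a) | ≡ᵇ-false a≢n | <ᵇ-false (ℕ.≤⇒≯ n<a) =
    ℚ.+-identityˡ 0ℚ

  if-*ˡ : ∀ b c y → c * (if b then y else 0ℚ) ≡ (if b then c * y else 0ℚ)
  if-*ˡ true  c y = refl
  if-*ˡ false c y = ℚ.*-zeroʳ c

  if-*ʳ : ∀ b y c → (if b then y else 0ℚ) * c ≡ (if b then y * c else 0ℚ)
  if-*ʳ true  y c = refl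
  if-*ʳ false y c = ℚ.*-zeroˡ c

  ∑-if : ∀ n b f → ∑ n (λ i → if b then f i else 0ℚ) ≡ (if b then ∑ n f else 0ℚ)
  ∑-if n true  f = refl
  ∑-if n false f = ∑-zero n (λ _ _ → refl)

  ≡ᵇ-iff : ∀ {a b c d} → (a ≡ b → c ≡ d) → (c ≡ d → a ≡ b) → (a ≡ᵇ b) ≡ (c ≡ᵇ d)
  ≡ᵇ-iff {a} {b} {c} {d} to from = det (≡ᵇ-reflects a b)
    (fromEquivalence (λ c≡ᵇd → from (ℕ.≡ᵇ⇒≡ c d c≡ᵇd)) (λ a≡b → ℕ.≡⇒≡ᵇ c d (to a≡b)))

  ≡ᵇ-+-split : ∀ a w n (v : ℚ) →
           (if a ℕ.+ w ≡ᵇ n then v else 0ℚ) ≡ (if a <ᵇ suc n then (if w ≡ᵇ n ∸ a then v else 0ℚ) else 0ℚ)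
  ≡ᵇ-+-split a w n v with a ℕ.≤? n
  ... | yes a≤n rewrite <ᵇ-true (s≤s a≤n) =
    cong (if_then v else 0ℚ) (≡ᵇ-iff (λ a+w≡n → trans (sym (ℕ.m+n∸m≡n a w)) (cong (_∸ a) a+w≡n))
                                      (λ w≡n∸a → trans (cong (a ℕ.+_) w≡n∸a) (ℕ.m+[n∸m]≡n a≤n)))
  ... | no  a≰n rewrite <ᵇ-false (λ a<sn → a≰n (ℕ.≤-pred a<sn))
                      | ≡ᵇ-false {a ℕ.+ w} {n} (λ a+w≡n → a≰n (ℕ.≤-trans (ℕ.m≤m+n a w) (ℕ.≤-reflexive a+w≡n))) = refl

  ∑ₗ : {A : Set} → List A → (A → ℚ) → ℚ
  ∑ₗ []       f = 0ℚ
  ∑ₗ (x ∷ xs) f = f x + ∑ₗ xs f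

  module _ {A : Set} where

    ∑ₗ-cong : ∀ (xs : List A) {f g} → (∀ x → f x ≡ g x) → ∑ₗ xs f ≡ ∑ₗ xs g
    ∑ₗ-cong []       f≗g = refl
    ∑ₗ-cong (x ∷ xs) f≗g = cong₂ _+_ (f≗g x) (∑ₗ-cong xs f≗g)

    ∑ₗ-zero : ∀ (xs : List A) {f} → (∀ x → f x ≡ 0ℚ) → ∑ₗ xs f ≡ 0ℚ
    ∑ₗ-zero []       f≗0 = refl
    ∑ₗ-zero (x ∷ xs) f≗0 = trans (cong₂ _+_ (f≗0 x) (∑ₗ-zero xs f≗0)) (ℚ.+-identityˡ 0ℚ)

    ∑ₗ-*ˡ : ∀ (xs : List A) c f → ∑ₗ xs (λ x → c * f x) ≡ c * ∑ₗ xs f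
    ∑ₗ-*ˡ []       c f = sym (ℚ.*-zeroʳ c)
    ∑ₗ-*ˡ (x ∷ xs) c f = trans (cong (c * f x +_) (∑ₗ-*ˡ xs c f)) (sym (ℚ.*-distribˡ-+ c (f x) _))

    ∑ₗ-++ : ∀ (xs ys : List A) f → ∑ₗ (xs ++ ys) f ≡ ∑ₗ xs f + ∑ₗ ys f
    ∑ₗ-++ []       ys f = sym (ℚ.+-identityˡ (∑ₗ ys f))
    ∑ₗ-++ (x ∷ xs) ys f = trans (cong (f x +_) (∑ₗ-++ xs ys f)) (sym (ℚ.+-assoc (f x) _ _))

    ∑ₗ-applyUpTo : ∀ (g : ℕ → A) n f → ∑ₗ (applyUpTo g n) f ≡ ∑ n (λ i → f (g i))
    ∑ₗ-applyUpTo g zero    f = refl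
    ∑ₗ-applyUpTo g (suc n) f =
      trans (cong (f (g 0) +_) (∑ₗ-applyUpTo (λ i → g (suc i)) n f)) (sym (∑-head n (λ i → f (g i))))

  module _ {A B : Set} where

    ∑ₗ-map : ∀ (g : A → B) xs f → ∑ₗ (map g xs) f ≡ ∑ₗ xs (λ x → f (g x))
    ∑ₗ-map g []       f = refl
    ∑ₗ-map g (x ∷ xs) f = cong (f (g x) +_) (∑ₗ-map g xs f)

    ∑ₗ-concatMap : ∀ (h : A → List B) xs f → ∑ₗ (concatMap h xs) f ≡ ∑ₗ xs (λ x → ∑ₗ (h x) f)
    ∑ₗ-concatMap h []       f = refl
    ∑ₗ-concatMap h (x ∷ xs) f = trans (∑ₗ-++ (h x) (concatMap h xs) f) (cong (∑ₗ (h x) f +_) (∑ₗ-concatMap h xs f))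

  ∑ₗ-if : ∀ {A : Set} (xs : List A) b f → ∑ₗ xs (λ x → if b then f x else 0ℚ) ≡ (if b then ∑ₗ xs f else 0ℚ)
  ∑ₗ-if xs true  f = refl
  ∑ₗ-if xs false f = ∑ₗ-zero xs (λ _ → refl)

  Series : Set
  Series = ℕ → ℚ

  infixl 7 _⋆_
  _⋆_ : Series → Series → Series
  (A ⋆ B) n = ∑ (suc n) (λ i → A i * B (n ∸ i))

  ⋆-cong : ∀ {A A′ B B′} n → (∀ i → i ℕ.≤ n → A i ≡ A′ i) → (∀ i → i ℕ.≤ n → B i ≡ B′ i) →
           (A ⋆ B) n ≡ (A′ ⋆ B′) n
  ⋆-cong n A≗A′ B≗B′ =
    ∑-cong (suc n) (λ i i<sn → cong₂ _*_ (A≗A′ i (ℕ.≤-pred i<sn)) (B≗B′ (n ∸ i) (ℕ.m∸n≤m n i)))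

  ⋆-comm : ∀ A B n → (A ⋆ B) n ≡ (B ⋆ A) n
  ⋆-comm A B n = begin
    ∑ (suc n) (λ i → A i * B (n ∸ i))                ≡⟨ ∑-reverse (suc n) (λ i → A i * B (n ∸ i)) ⟩
    ∑ (suc n) (λ i → A (n ∸ i) * B (n ∸ (n ∸ i)))    ≡⟨ ∑-cong (suc n) flip ⟩
    ∑ (suc n) (λ i → B i * A (n ∸ i))                ∎
    where
    flip : ∀ i → i ℕ.< suc n → A (n ∸ i) * B (n ∸ (n ∸ i)) ≡ B i * A (n ∸ i)
    flip i i<sn = trans (ℚ.*-comm (A (n ∸ i)) _) (cong (λ j → B j * A (n ∸ i)) (ℕ.m∸[m∸n]≡n (ℕ.≤-pred i<sn)))

  ⋆-assoc : ∀ A B C n → ((A ⋆ B) ⋆ C) n ≡ (A ⋆ (B ⋆ C)) n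
  ⋆-assoc A B C n = begin
    ∑ (suc n) (λ i → (A ⋆ B) i * C (n ∸ i))
      ≡⟨ ∑-cong (suc n) (λ i _ → sym (∑-*ʳ (suc i) (λ j → A j * B (i ∸ j)) (C (n ∸ i)))) ⟩
    ∑ (suc n) (λ i → ∑ (suc i) (λ j → h j i))
      ≡⟨ ∑-triangle (suc n) h ⟩
    ∑ (suc n) (λ j → ∑ (suc n ∸ j) (λ l → h j (j ℕ.+ l)))
      ≡⟨ ∑-cong (suc n) (λ j j<sn → row j (ℕ.≤-pred j<sn)) ⟩
    ∑ (suc n) (λ j → A j * (B ⋆ C) (n ∸ j))          ∎
    where
    h : ℕ → ℕ → ℚ
    h j i = (A j * B (i ∸ j)) * C (n ∸ i)
    row : ∀ j → j ℕ.≤ n → ∑ (suc n ∸ j) (λ l → h j (j ℕ.+ l)) ≡ A j * (B ⋆ C) (n ∸ j)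
    row j j≤n = begin
      ∑ (suc n ∸ j) (λ l → h j (j ℕ.+ l))                ≡⟨ cong (λ m → ∑ m (λ l → h j (j ℕ.+ l))) (ℕ.+-∸-assoc 1 j≤n) ⟩
      ∑ (suc (n ∸ j)) (λ l → h j (j ℕ.+ l))              ≡⟨ ∑-cong (suc (n ∸ j)) (λ l _ → reindex l) ⟩
      ∑ (suc (n ∸ j)) (λ l → A j * (B l * C (n ∸ j ∸ l)))  ≡⟨ ∑-*ˡ (suc (n ∸ j)) (A j) _ ⟩
      A j * (B ⋆ C) (n ∸ j)                              ∎
      where
      reindex : ∀ l → h j (j ℕ.+ l) ≡ A j * (B l * C (n ∸ j ∸ l))
      reindex l = trans (ℚ.*-assoc (A j) _ _)
        (cong₂ (λ u v → A j * (B u * C v)) (ℕ.m+n∸m≡n j l) (sym (ℕ.∸-+-assoc n j l)))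

  ⋆-distribʳ : ∀ A B C n → (A ⋆ C) n + (B ⋆ C) n ≡ ((λ i → A i + B i) ⋆ C) n
  ⋆-distribʳ A B C n = trans (sym (∑-+ (suc n) _ _))
    (∑-cong (suc n) (λ i _ → sym (ℚ.*-distribʳ-+ (C (n ∸ i)) (A i) (B i))))

  ⋆-monoʳ : ∀ {A B B′} n → (∀ i → i ℕ.≤ n → 0ℚ ≤ A i) → (∀ i → i ℕ.≤ n → B i ≤ B′ i) →
            (A ⋆ B) n ≤ (A ⋆ B′) n
  ⋆-monoʳ {A} n A≥0 B≤B′ = ∑-mono (suc n) (λ i i<sn →
    ℚ.*-monoˡ-≤-nonNeg (A i) {{ℚ.nonNegative (A≥0 i (ℕ.≤-pred i<sn))}} (B≤B′ (n ∸ i) (ℕ.m∸n≤m n i)))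

  -- The Euler operator θ = X·d/dX multiplies the n-th coefficient by n; it is a derivation.
  θ : Series → Series
  θ A n = ι n * A n

  θ-leibniz : ∀ A B n → θ (A ⋆ B) n ≡ (θ A ⋆ B) n + (A ⋆ θ B) n
  θ-leibniz A B n = begin
    ι n * ∑ (suc n) (λ i → A i * B (n ∸ i))                  ≡⟨ ∑-*ˡ (suc n) (ι n) _ ⟨
    ∑ (suc n) (λ i → ι n * (A i * B (n ∸ i)))                ≡⟨ ∑-cong (suc n) (λ i i<sn → split i (ℕ.≤-pred i<sn)) ⟩
    ∑ (suc n) (λ i → θ A i * B (n ∸ i) + A i * θ B (n ∸ i))  ≡⟨ ∑-+ (suc n) _ _ ⟩
    (θ A ⋆ B) n + (A ⋆ θ B) n                                ∎
    where
    split : ∀ i → i ℕ.≤ n → ι n * (A i * B (n ∸ i)) ≡ θ A i * B (n ∸ i) + A i * θ B (n ∸ i)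
    split i i≤n = trans (cong (_* (A i * B (n ∸ i))) (ι-∸ i≤n))
      (solve 4 (λ x y u v → (x :+ y) :* (u :* v) := (x :* u) :* v :+ u :* (y :* v)) refl
        (ι i) (ι (n ∸ i)) (A i) (B (n ∸ i)))

  -- The recurrence n·Aₙ = Σ_{1≤i≤n} wᵢ·A_{n−i} at index n. Holding for all n it says
  -- θ A = (Σ_{i≥1} wᵢ Xⁱ)·A, i.e. A = A₀ · exp (Σ_{i≥1} wᵢ Xⁱ / i).
  ExpRec : Series → Series → ℕ → Set
  ExpRec w A n = θ A n ≡ ∑ n (λ i → w (suc i) * A (n ∸ suc i))

  dropConst : Series → Series
  dropConst w zero    = 0ℚ
  dropConst w (suc i) = w (suc i)

  ⋆-dropConst : ∀ w A n → (dropConst w ⋆ A) n ≡ ∑ n (λ i → w (suc i) * A (n ∸ suc i))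
  ⋆-dropConst w A n = begin
    (dropConst w ⋆ A) n                          ≡⟨ ∑-head n (λ i → dropConst w i * A (n ∸ i)) ⟩
    0ℚ * A n + ∑ n (λ i → w (suc i) * A (n ∸ suc i))  ≡⟨ cong (_+ ∑ n (λ i → w (suc i) * A (n ∸ suc i))) (ℚ.*-zeroˡ (A n)) ⟩
    0ℚ + ∑ n (λ i → w (suc i) * A (n ∸ suc i))   ≡⟨ ℚ.+-identityˡ _ ⟩
    ∑ n (λ i → w (suc i) * A (n ∸ suc i))        ∎

  expRec-weights : ∀ w w′ A n → (∀ i → i ℕ.< n → w (suc i) ≡ w′ (suc i)) → ExpRec w A n → ExpRec w′ A n
  expRec-weights w w′ A n w≗w′ rec = trans rec (∑-cong n (λ i i<n → cong (_* A (n ∸ suc i)) (w≗w′ i i<n)))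

  expRec-series : ∀ w A A′ n → (∀ i → i ℕ.≤ n → A i ≡ A′ i) → ExpRec w A n → ExpRec w A′ n
  expRec-series w A A′ n A≗A′ rec = begin
    ι n * A′ n                              ≡⟨ cong (ι n *_) (A≗A′ n ℕ.≤-refl) ⟨
    ι n * A n                               ≡⟨ rec ⟩
    ∑ n (λ i → w (suc i) * A (n ∸ suc i))   ≡⟨ ∑-cong n (λ i _ → cong (w (suc i) *_) (A≗A′ (n ∸ suc i) (ℕ.m∸n≤m n (suc i)))) ⟩
    ∑ n (λ i → w (suc i) * A′ (n ∸ suc i))  ∎

  expRec-unique : ∀ K w A B → (∀ n → n ℕ.≤ K → ExpRec w A n) → (∀ n → n ℕ.≤ K → ExpRec w B n) →
                  A 0 ≡ B 0 → ∀ n → n ℕ.≤ K → A n ≡ B n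
  expRec-unique K w A B recA recB A₀≡B₀ n n≤K = agreeUpTo n n≤K n ℕ.≤-refl
    where
    agreeUpTo : ∀ n → n ℕ.≤ K → ∀ m → m ℕ.≤ n → A m ≡ B m
    agreeUpTo zero    _    zero _ = A₀≡B₀
    agreeUpTo (suc n) sn≤K m m≤sn with ℕ.m≤n⇒m<n∨m≡n m≤sn
    ... | inj₁ m<sn = agreeUpTo n (ℕ.≤-trans (ℕ.n≤1+n n) sn≤K) m (ℕ.≤-pred m<sn)
    ... | inj₂ refl = ι-cancelˡ n (begin
      ι (suc n) * A (suc n)                     ≡⟨ recA (suc n) sn≤K ⟩
      ∑ (suc n) (λ i → w (suc i) * A (n ∸ i))   ≡⟨ ∑-cong (suc n) (λ i _ → cong (w (suc i) *_) (earlier i)) ⟩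
      ∑ (suc n) (λ i → w (suc i) * B (n ∸ i))   ≡⟨ recB (suc n) sn≤K ⟨
      ι (suc n) * B (suc n)                     ∎)
      where
      earlier : ∀ i → A (n ∸ i) ≡ B (n ∸ i)
      earlier i = agreeUpTo n (ℕ.≤-trans (ℕ.n≤1+n n) sn≤K) (n ∸ i) (ℕ.m∸n≤m n i)

  expRec-⋆ : ∀ a b A B n → (∀ i → i ℕ.≤ n → ExpRec a A i) → (∀ i → i ℕ.≤ n → ExpRec b B i) →
             ExpRec (λ i → a i + b i) (A ⋆ B) n
  expRec-⋆ a b A B n recA recB = begin
    θ (A ⋆ B) n                                   ≡⟨ θ-leibniz A B n ⟩
    (θ A ⋆ B) n + (A ⋆ θ B) n                     ≡⟨ cong₂ _+_ (⋆-cong {B = B} n θA≗ (λ _ _ → refl)) (⋆-cong {A = A} n (λ _ _ → refl) θB≗) ⟩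
    ((ã ⋆ A) ⋆ B) n + (A ⋆ (b̃ ⋆ B)) n             ≡⟨ cong₂ _+_ (⋆-assoc ã A B n) rearrange ⟩
    (ã ⋆ (A ⋆ B)) n + (b̃ ⋆ (A ⋆ B)) n             ≡⟨ ⋆-distribʳ ã b̃ (A ⋆ B) n ⟩
    ((λ i → ã i + b̃ i) ⋆ (A ⋆ B)) n               ≡⟨ ⋆-cong {B = A ⋆ B} {B′ = A ⋆ B} n dropConst-+ (λ _ _ → refl) ⟩
    (dropConst (λ i → a i + b i) ⋆ (A ⋆ B)) n     ≡⟨ ⋆-dropConst (λ i → a i + b i) (A ⋆ B) n ⟩
    ∑ n (λ i → (a (suc i) + b (suc i)) * (A ⋆ B) (n ∸ suc i))  ∎
    where
    ã = dropConst a
    b̃ = dropConst b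
    θA≗ : ∀ i → i ℕ.≤ n → θ A i ≡ (ã ⋆ A) i
    θA≗ i i≤n = trans (recA i i≤n) (sym (⋆-dropConst a A i))
    θB≗ : ∀ i → i ℕ.≤ n → θ B i ≡ (b̃ ⋆ B) i
    θB≗ i i≤n = trans (recB i i≤n) (sym (⋆-dropConst b B i))
    rearrange : (A ⋆ (b̃ ⋆ B)) n ≡ (b̃ ⋆ (A ⋆ B)) n
    rearrange = begin
      (A ⋆ (b̃ ⋆ B)) n   ≡⟨ ⋆-comm A (b̃ ⋆ B) n ⟩
      ((b̃ ⋆ B) ⋆ A) n   ≡⟨ ⋆-assoc b̃ B A n ⟩
      (b̃ ⋆ (B ⋆ A)) n   ≡⟨ ⋆-cong {b̃} {b̃} n (λ _ _ → refl) (λ i _ → ⋆-comm B A i) ⟩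
      (b̃ ⋆ (A ⋆ B)) n   ∎
    dropConst-+ : ∀ i → i ℕ.≤ n → ã i + b̃ i ≡ dropConst (λ i → a i + b i) i
    dropConst-+ zero    _ = ℚ.+-identityˡ 0ℚ
    dropConst-+ (suc i) _ = refl

  -- The series (1 − X)^(−x), whose n-th coefficient is x (x + 1) ⋯ (x + n − 1) / n!.
  negBinom : ℕ → Series
  negBinom x zero    = 1ℚ
  negBinom x (suc n) = negBinom x n * (ι (x ℕ.+ n) * ι⁻¹ (suc n))

  negBinom-step : ∀ x n → ι (suc n) * negBinom x (suc n) ≡ ι (x ℕ.+ n) * negBinom x n
  negBinom-step x n = begin
    ι (suc n) * (negBinom x n * (ι (x ℕ.+ n) * ι⁻¹ (suc n)))
      ≡⟨ solve 4 (λ a b c e → a :* (b :* (c :* e)) := (c :* b) :* (a :* e)) refl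
           (ι (suc n)) (negBinom x n) (ι (x ℕ.+ n)) (ι⁻¹ (suc n)) ⟩
    (ι (x ℕ.+ n) * negBinom x n) * (ι (suc n) * ι⁻¹ (suc n))  ≡⟨ cong (ι (x ℕ.+ n) * negBinom x n *_) (ι-inverse (suc n)) ⟩
    (ι (x ℕ.+ n) * negBinom x n) * 1ℚ                         ≡⟨ ℚ.*-identityʳ _ ⟩
    ι (x ℕ.+ n) * negBinom x n                                ∎

  negBinom-partialSum : ∀ x n → ι x * ∑ n (negBinom x) ≡ ι n * negBinom x n
  negBinom-partialSum x zero    = trans (ℚ.*-zeroʳ (ι x)) (sym (ℚ.*-zeroˡ 1ℚ))
  negBinom-partialSum x (suc n) = begin
    ι x * (∑ n (negBinom x) + negBinom x n)              ≡⟨ ℚ.*-distribˡ-+ (ι x) _ _ ⟩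
    ι x * ∑ n (negBinom x) + ι x * negBinom x n          ≡⟨ cong (_+ ι x * negBinom x n) (negBinom-partialSum x n) ⟩
    ι n * negBinom x n + ι x * negBinom x n              ≡⟨ ℚ.*-distribʳ-+ (negBinom x n) (ι n) (ι x) ⟨
    (ι n + ι x) * negBinom x n                           ≡⟨ cong (_* negBinom x n) (trans (sym (ι-+ n x)) (cong ι (ℕ.+-comm n x))) ⟩
    ι (x ℕ.+ n) * negBinom x n                           ≡⟨ negBinom-step x n ⟨
    ι (suc n) * negBinom x (suc n)                       ∎

  negBinom-expRec : ∀ x n → ExpRec (λ _ → ι x) (negBinom x) n
  negBinom-expRec x n = sym (begin
    ∑ n (λ i → ι x * negBinom x (n ∸ suc i))  ≡⟨ ∑-*ˡ n (ι x) _ ⟩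
    ι x * ∑ n (λ i → negBinom x (n ∸ suc i))  ≡⟨ cong (ι x *_) (∑-reverse n (negBinom x)) ⟨
    ι x * ∑ n (negBinom x)                    ≡⟨ negBinom-partialSum x n ⟩
    ι n * negBinom x n                        ∎)

  negBinom-⋆ : ∀ x y n → (negBinom x ⋆ negBinom y) n ≡ negBinom (x ℕ.+ y) n
  negBinom-⋆ x y n = expRec-unique n (λ _ → ι (x ℕ.+ y)) _ _ productRec (λ i _ → negBinom-expRec (x ℕ.+ y) i)
    (trans (ℚ.+-identityˡ (1ℚ * 1ℚ)) (ℚ.*-identityˡ 1ℚ)) n ℕ.≤-refl
    where
    productRec : ∀ i → i ℕ.≤ n → ExpRec (λ _ → ι (x ℕ.+ y)) (negBinom x ⋆ negBinom y) i
    productRec i _ = expRec-weights (λ _ → ι x + ι y) (λ _ → ι (x ℕ.+ y)) (negBinom x ⋆ negBinom y) i (λ _ _ → sym (ι-+ x y))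
      (expRec-⋆ (λ _ → ι x) (λ _ → ι y) (negBinom x) (negBinom y) i (λ j _ → negBinom-expRec x j) (λ j _ → negBinom-expRec y j))

  negBinom-nonneg : ∀ x n → 0ℚ ≤ negBinom x n
  negBinom-nonneg x zero    = ℚ.<⇒≤ (ℚ.positive⁻¹ 1ℚ)
  negBinom-nonneg x (suc n) = *-nonneg (negBinom-nonneg x n) (*-nonneg (ι-nonneg (x ℕ.+ n)) (ι⁻¹-nonneg (suc n)))

  negBinom-mono : ∀ x {a b} → 1 ℕ.≤ x → a ℕ.≤ b → negBinom x a ≤ negBinom x b
  negBinom-mono x {a} {b} 1≤x a≤b with ℕ.m≤n⇒m<n∨m≡n a≤b
  ... | inj₂ refl = ℚ.≤-refl
  negBinom-mono x {a} {suc b} 1≤x a≤b | inj₁ a<sb =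
    ℚ.≤-trans (negBinom-mono x 1≤x (ℕ.≤-pred a<sb)) increase
    where
    increase : negBinom x b ≤ negBinom x (suc b)
    increase = ℚ.*-cancelˡ-≤-pos (ι (suc b)) {{ℚ.positive (ι-pos b)}} (≤.begin
      ι (suc b) * negBinom x b       ≤.≤⟨ ℚ.*-monoʳ-≤-nonNeg (negBinom x b) {{ℚ.nonNegative (negBinom-nonneg x b)}}
                                                            (ι-mono (ℕ.+-monoˡ-≤ b 1≤x)) ⟩
      ι (x ℕ.+ b) * negBinom x b     ≤.≡⟨ negBinom-step x b ⟨
      ι (suc b) * negBinom x (suc b) ≤.∎)

  negBinom-zero : ∀ n → negBinom 0 (suc n) ≡ 0ℚ
  negBinom-zero zero    = trans (ℚ.*-identityˡ _) (ℚ.*-zeroˡ (ι⁻¹ (suc 0)))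
  negBinom-zero (suc n) = trans (cong (_* ratio) (negBinom-zero n)) (ℚ.*-zeroˡ ratio)
    where ratio = ι (suc n) * ι⁻¹ (suc (suc n))

  fallingFactorial-top : ∀ x k → fallingFactorial x (suc k) ≡ x ℕ.* fallingFactorial (x ∸ 1) k
  fallingFactorial-top x zero    = trans (ℕ.*-identityˡ x) (sym (ℕ.*-identityʳ x))
  fallingFactorial-top x (suc k) = begin
    fallingFactorial x (suc k) ℕ.* (x ∸ suc k)                  ≡⟨ cong (ℕ._* (x ∸ suc k)) (fallingFactorial-top x k) ⟩
    x ℕ.* fallingFactorial (x ∸ 1) k ℕ.* (x ∸ suc k)            ≡⟨ ℕ.*-assoc x _ _ ⟩
    x ℕ.* (fallingFactorial (x ∸ 1) k ℕ.* (x ∸ suc k))          ≡⟨ cong (λ z → x ℕ.* (fallingFactorial (x ∸ 1) k ℕ.* z)) (sym (ℕ.∸-+-assoc x 1 k)) ⟩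
    x ℕ.* fallingFactorial (x ∸ 1) (suc k)                      ∎

  negBinom-factorial : ∀ y k → ι (k !) * negBinom (suc y) k ≡ ι (fallingFactorial (y ℕ.+ k) k)
  negBinom-factorial y zero    = ℚ.*-identityʳ (ι 1)
  negBinom-factorial y (suc k) = begin
    ι (suc k ℕ.* k !) * negBinom (suc y) (suc k)
      ≡⟨ cong (_* negBinom (suc y) (suc k)) (ι-* (suc k) (k !)) ⟩
    (ι (suc k) * ι (k !)) * negBinom (suc y) (suc k)
      ≡⟨ solve 3 (λ a b c → (a :* b) :* c := b :* (a :* c)) refl (ι (suc k)) (ι (k !)) (negBinom (suc y) (suc k)) ⟩
    ι (k !) * (ι (suc k) * negBinom (suc y) (suc k))
      ≡⟨ cong (ι (k !) *_) (negBinom-step (suc y) k) ⟩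
    ι (k !) * (ι (suc y ℕ.+ k) * negBinom (suc y) k)
      ≡⟨ solve 3 (λ a b c → a :* (b :* c) := b :* (a :* c)) refl (ι (k !)) (ι (suc y ℕ.+ k)) (negBinom (suc y) k) ⟩
    ι (suc y ℕ.+ k) * (ι (k !) * negBinom (suc y) k)
      ≡⟨ cong (ι (suc y ℕ.+ k) *_) (negBinom-factorial y k) ⟩
    ι (suc y ℕ.+ k) * ι (fallingFactorial (y ℕ.+ k) k)
      ≡⟨ ι-* (suc y ℕ.+ k) (fallingFactorial (y ℕ.+ k) k) ⟨
    ι (suc (y ℕ.+ k) ℕ.* fallingFactorial (y ℕ.+ k) k)
      ≡⟨ cong ι (fallingFactorial-top (suc (y ℕ.+ k)) k) ⟨
    ι (fallingFactorial (suc (y ℕ.+ k)) (suc k))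
      ≡⟨ cong (λ z → ι (fallingFactorial z (suc k))) (ℕ.+-suc y k) ⟨
    ι (fallingFactorial (y ℕ.+ suc k) (suc k))
      ∎

  -- The series (1 − X^d)^(−m) = Σⱼ [Xʲ](1 − X)^(−m) · X^(d j); its recurrence weights are d·m at the
  -- multiples of d and 0 elsewhere, since (1 − X^d)^(−m) = exp (d m · Σ_{d ∣ i} Xⁱ / i).
  module Dilated (d : ℕ) .{{_ : ℕ.NonZero d}} (m : ℕ) where

    weight : Series
    weight i = if does (d ∣? i) then ι (m ℕ.* d) else 0ℚ

    dilated : Series
    dilated n = if does (d ∣? n) then negBinom m (n / d) else 0ℚ

    weight-∣ : ∀ {i} → d ∣ i → weight i ≡ ι (m ℕ.* d)
    weight-∣ {i} d∣i with d ∣? i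
    ... | yes _  = refl
    ... | no d∤i = ⊥-elim (d∤i d∣i)

    weight-∤ : ∀ {i} → ¬ d ∣ i → weight i ≡ 0ℚ
    weight-∤ {i} d∤i with d ∣? i
    ... | yes d∣i = ⊥-elim (d∤i d∣i)
    ... | no _    = refl

    dilated-∣ : ∀ j → dilated (j ℕ.* d) ≡ negBinom m j
    dilated-∣ j with d ∣? (j ℕ.* d)
    ... | yes _  = cong (negBinom m) (m*n/n≡m j d)
    ... | no d∤n = ⊥-elim (d∤n (n∣m*n j))

    dilated-∤ : ∀ {n} → ¬ d ∣ n → dilated n ≡ 0ℚ
    dilated-∤ {n} d∤n with d ∣? n
    ... | yes d∣n = ⊥-elim (d∤n d∣n)
    ... | no _    = refl

    weight-periodic : ∀ i → weight (d ℕ.+ i) ≡ weight i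
    weight-periodic i with d ∣? i
    ... | yes d∣i = weight-∣ (∣m∣n⇒∣m+n ∣-refl d∣i)
    ... | no d∤i  = weight-∤ (λ d∣d+i → d∤i (∣m+n∣m⇒∣n d∣d+i ∣-refl))

    -- The right-hand side of the recurrence at n = j d, computed block by block of length d:
    -- in each block only the last weight (at a multiple of d) is nonzero.
    blocks : ∀ j → ∑ (j ℕ.* d) (λ i → weight (suc i) * dilated (j ℕ.* d ∸ suc i)) ≡ ι (m ℕ.* d) * ∑ j (negBinom m)
    blocks zero    = sym (ℚ.*-zeroʳ (ι (m ℕ.* d)))
    blocks (suc j) = begin
      ∑ (d ℕ.+ j ℕ.* d) f                                     ≡⟨ ∑-split d (j ℕ.* d) f ⟩
      ∑ d f + ∑ (j ℕ.* d) (λ i → f (d ℕ.+ i))                 ≡⟨ cong₂ _+_ firstBlock laterBlocks ⟩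
      ι (m ℕ.* d) * negBinom m j + ι (m ℕ.* d) * ∑ j (negBinom m)  ≡⟨ ℚ.*-distribˡ-+ (ι (m ℕ.* d)) _ _ ⟨
      ι (m ℕ.* d) * (negBinom m j + ∑ j (negBinom m))         ≡⟨ cong (ι (m ℕ.* d) *_) (ℚ.+-comm (negBinom m j) _) ⟩
      ι (m ℕ.* d) * ∑ (suc j) (negBinom m)                    ∎
      where
      f : ℕ → ℚ
      f i = weight (suc i) * dilated (d ℕ.+ j ℕ.* d ∸ suc i)
      d′ = ℕ.pred d
      d′+1≡d : suc d′ ≡ d
      d′+1≡d = ℕ.suc-pred d
      firstBlock : ∑ d f ≡ ι (m ℕ.* d) * negBinom m j
      firstBlock = begin
        ∑ d f                                       ≡⟨ cong (λ n → ∑ n f) d′+1≡d ⟨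
        ∑ d′ f + f d′                               ≡⟨ cong (_+ f d′) (∑-zero d′ (λ i i<d′ → inner i i<d′)) ⟩
        0ℚ + f d′                                   ≡⟨ ℚ.+-identityˡ (f d′) ⟩
        weight (suc d′) * dilated (d ℕ.+ j ℕ.* d ∸ suc d′)  ≡⟨ cong (λ e → weight e * dilated (d ℕ.+ j ℕ.* d ∸ e)) d′+1≡d ⟩
        weight d * dilated (d ℕ.+ j ℕ.* d ∸ d)      ≡⟨ cong (λ n → weight d * dilated n) (ℕ.m+n∸m≡n d (j ℕ.* d)) ⟩
        weight d * dilated (j ℕ.* d)                ≡⟨ cong₂ _*_ (weight-∣ ∣-refl) (dilated-∣ j) ⟩
        ι (m ℕ.* d) * negBinom m j                  ∎
        where
        inner : ∀ i → i ℕ.< d′ → f i ≡ 0ℚ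
        inner i i<d′ = trans (cong (_* dilated (d ℕ.+ j ℕ.* d ∸ suc i))
                                    (weight-∤ (>⇒∤ (ℕ.≤-trans (s≤s i<d′) (ℕ.≤-reflexive d′+1≡d)))))
                             (ℚ.*-zeroˡ (dilated (d ℕ.+ j ℕ.* d ∸ suc i)))
      laterBlocks : ∑ (j ℕ.* d) (λ i → f (d ℕ.+ i)) ≡ ι (m ℕ.* d) * ∑ j (negBinom m)
      laterBlocks = trans (∑-cong (j ℕ.* d) (λ i _ → cong₂ _*_
          (trans (cong weight (sym (ℕ.+-suc d i))) (weight-periodic (suc i)))
          (cong dilated (trans (cong (d ℕ.+ j ℕ.* d ∸_) (sym (ℕ.+-suc d i))) (ℕ.[m+n]∸[m+o]≡n∸o d (j ℕ.* d) (suc i))))))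
        (blocks j)

    dilated-expRec : ∀ n → ExpRec weight dilated n
    dilated-expRec n with d ∣? n
    ... | no d∤n = sym (trans (∑-zero n vanish) (sym (ℚ.*-zeroʳ (ι n))))
      where
      -- if d ∣ i + 1 and d ∣ n − (i + 1) then d ∣ n
      vanish : ∀ i → i ℕ.< n → weight (suc i) * dilated (n ∸ suc i) ≡ 0ℚ
      vanish i i<n with d ∣? suc i
      ... | no _      = ℚ.*-zeroˡ (dilated (n ∸ suc i))
      ... | yes d∣i+1 = trans (cong (ι (m ℕ.* d) *_) (dilated-∤ (λ d∣rest → d∤n (∣m∸n∣n⇒∣m d i<n d∣rest d∣i+1))))
                              (ℚ.*-zeroʳ (ι (m ℕ.* d)))
    ... | yes (divides j refl) = begin
      ι (j ℕ.* d) * negBinom m (j ℕ.* d / d)  ≡⟨ cong₂ _*_ (trans (ι-* j d) (ℚ.*-comm (ι j) (ι d))) (cong (negBinom m) (m*n/n≡m j d)) ⟩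
      (ι d * ι j) * negBinom m j              ≡⟨ ℚ.*-assoc (ι d) (ι j) (negBinom m j) ⟩
      ι d * (ι j * negBinom m j)              ≡⟨ cong (ι d *_) (negBinom-partialSum m j) ⟨
      ι d * (ι m * ∑ j (negBinom m))          ≡⟨ solve 3 (λ a b c → a :* (b :* c) := (b :* a) :* c) refl (ι d) (ι m) (∑ j (negBinom m)) ⟩
      (ι m * ι d) * ∑ j (negBinom m)          ≡⟨ cong (_* ∑ j (negBinom m)) (ι-* m d) ⟨
      ι (m ℕ.* d) * ∑ j (negBinom m)          ≡⟨ blocks j ⟨
      ∑ (j ℕ.* d) (λ i → weight (suc i) * dilated (j ℕ.* d ∸ suc i))  ∎

    dilated≤negBinom : ∀ n → dilated n ≤ negBinom m n
    dilated≤negBinom n with d ∣? n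
    ... | no _ = negBinom-nonneg m n
    ... | yes (divides j refl) = ℚ.≤-trans (ℚ.≤-reflexive (cong (negBinom m) (m*n/n≡m j d))) (spread m j)
      where
      spread : ∀ x j → negBinom x j ≤ negBinom x (j ℕ.* d)
      spread x       zero    = ℚ.≤-refl
      spread zero    (suc j) = ℚ.≤-trans (ℚ.≤-reflexive (negBinom-zero j)) (negBinom-nonneg 0 (suc j ℕ.* d))
      spread (suc x) (suc j) = negBinom-mono (suc x) (s≤s z≤n) (ℕ.m≤m*n (suc j) d)

  -- Regrouping a product of four naturals; it splits (j+1)^(x+1) (x+1)! as ((x+1)(j+1)) · ((j+1)ˣ x!).
  *-regroup : ∀ p q r s → (p ℕ.* q) ℕ.* (r ℕ.* s) ≡ (r ℕ.* p) ℕ.* (q ℕ.* s)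
  *-regroup = solve-∀

  -- expCoeff τ j x = τˣ / ((j+1)ˣ x!), the coefficient of X^((j+1)x) in exp (τ X^(j+1) / (j+1)).
  expCoeff : ℚ → ℕ → ℕ → ℚ
  expCoeff τ j zero    = 1ℚ
  expCoeff τ j (suc x) = expCoeff τ j x * (τ * ι⁻¹ (suc x ℕ.* suc j))

  expCoeff-step : ∀ τ j x → ι (suc x ℕ.* suc j) * expCoeff τ j (suc x) ≡ τ * expCoeff τ j x
  expCoeff-step τ j x = begin
    ι a * (expCoeff τ j x * (τ * ι⁻¹ a))
      ≡⟨ solve 4 (λ p e t q → p :* (e :* (t :* q)) := (t :* e) :* (p :* q)) refl (ι a) (expCoeff τ j x) τ (ι⁻¹ a) ⟩
    (τ * expCoeff τ j x) * (ι a * ι⁻¹ a)  ≡⟨ cong (τ * expCoeff τ j x *_) (ι-inverse a) ⟩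
    (τ * expCoeff τ j x) * 1ℚ             ≡⟨ ℚ.*-identityʳ _ ⟩
    τ * expCoeff τ j x                    ∎
    where a = suc x ℕ.* suc j

  expCoeff-nonneg : ∀ {τ} j x → 0ℚ ≤ τ → 0ℚ ≤ expCoeff τ j x
  expCoeff-nonneg j zero    _   = ℚ.<⇒≤ (ℚ.positive⁻¹ 1ℚ)
  expCoeff-nonneg j (suc x) 0≤τ = *-nonneg (expCoeff-nonneg j x 0≤τ) (*-nonneg 0≤τ (ι⁻¹-nonneg (suc x ℕ.* suc j)))

  expCoeff-clear : ∀ T j x → ι (suc j ^ x ℕ.* x !) * expCoeff (ι T) j x ≡ ι (T ^ x)
  expCoeff-clear T j zero    = ℚ.*-identityʳ (ι 1)
  expCoeff-clear T j (suc x) = begin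
    ι (suc j ^ suc x ℕ.* suc x !) * (e * (ι T * ι⁻¹ a))   ≡⟨ cong (_* (e * (ι T * ι⁻¹ a))) (trans (cong ι regroup) (ι-* a D)) ⟩
    (ι a * ι D) * (e * (ι T * ι⁻¹ a))
      ≡⟨ solve 5 (λ p q r t u → (p :* q) :* (r :* (t :* u)) := (p :* u) :* ((q :* r) :* t)) refl (ι a) (ι D) e (ι T) (ι⁻¹ a) ⟩
    (ι a * ι⁻¹ a) * ((ι D * e) * ι T)                    ≡⟨ cong₂ (λ u v → u * (v * ι T)) (ι-inverse a) (expCoeff-clear T j x) ⟩
    1ℚ * (ι (T ^ x) * ι T)                               ≡⟨ ℚ.*-identityˡ _ ⟩
    ι (T ^ x) * ι T                                      ≡⟨ trans (cong ι (ℕ.*-comm T (T ^ x))) (ι-* (T ^ x) T) ⟨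
    ι (T ^ suc x)                                        ∎
    where
    a = suc x ℕ.* suc j
    D = suc j ^ x ℕ.* x !
    e = expCoeff (ι T) j x
    regroup : suc j ^ suc x ℕ.* suc x ! ≡ a ℕ.* D
    regroup = *-regroup (suc j) (suc j ^ x) (suc x) (x !)

  -- The weight Π_l t_l^(c_l) / (l^(c_l) c_l!) of a vector c = (c_{j+1}, c_{j+2}, …) of cycle multiplicities.
  typeWeight : (ℕ → ℕ) → ℕ → ∀ {m} → Vec ℕ m → ℚ
  typeWeight t j []      = 1ℚ
  typeWeight t j (x ∷ c) = expCoeff (ι (t (suc j))) j x * typeWeight t (suc j) c

  typeWeight-nonneg : ∀ t j {m} (c : Vec ℕ m) → 0ℚ ≤ typeWeight t j c
  typeWeight-nonneg t j []      = ℚ.<⇒≤ (ℚ.positive⁻¹ 1ℚ)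
  typeWeight-nonneg t j (x ∷ c) = *-nonneg (expCoeff-nonneg j x (ι-nonneg (t (suc j)))) (typeWeight-nonneg t (suc j) c)

  typeWeight-clear : ∀ t j {m} (c : Vec ℕ m) → ι (denomFrom j c) * typeWeight t j c ≡ ι (monoFrom t (suc j) c)
  typeWeight-clear t j []      = ℚ.*-identityʳ (ι 1)
  typeWeight-clear t j (x ∷ c) = begin
    ι (D ℕ.* denomFrom (suc j) c) * (e * typeWeight t (suc j) c)
      ≡⟨ cong (_* (e * typeWeight t (suc j) c)) (ι-* D (denomFrom (suc j) c)) ⟩
    (ι D * ι (denomFrom (suc j) c)) * (e * typeWeight t (suc j) c)
      ≡⟨ solve 4 (λ p q r s → (p :* q) :* (r :* s) := (p :* r) :* (q :* s)) refl (ι D) (ι (denomFrom (suc j) c)) e (typeWeight t (suc j) c) ⟩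
    (ι D * e) * (ι (denomFrom (suc j) c) * typeWeight t (suc j) c)
      ≡⟨ cong₂ _*_ (expCoeff-clear (t (suc j)) j x) (typeWeight-clear t (suc j) c) ⟩
    ι (t (suc j) ^ x) * ι (monoFrom t (suc (suc j)) c)
      ≡⟨ ι-* (t (suc j) ^ x) _ ⟨
    ι (monoFrom t (suc j) (x ∷ c))
      ∎
    where
    D = suc j ^ x ℕ.* x !
    e = expCoeff (ι (t (suc j))) j x

  -- The coefficient of Xⁿ in Π_{j<l≤j+m} Σ_{c≤b} (t_l X^l / l)^c / c!: the sum of the weights of the
  -- vectors (c_{j+1}, …, c_{j+m}) with entries ≤ b and Σ l c_l = n.
  cycleSeries : (ℕ → ℕ) → ℕ → ℕ → ℕ → Series
  cycleSeries t j m b n = ∑ₗ (allVecs m b) (λ c → if weightFrom (suc j) c ≡ᵇ n then typeWeight t j c else 0ℚ)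

  -- One factor Σ_{x≤b} (t_{j+1} X^(j+1) / (j+1))ˣ / x! of that product.
  cycleFactor : (ℕ → ℕ) → ℕ → ℕ → Series
  cycleFactor t j b n = ∑ (suc b) (λ x → if x ℕ.* suc j ≡ᵇ n then expCoeff (ι (t (suc j))) j x else 0ℚ)

  cycleSeries-suc : ∀ t j m b n → cycleSeries t j (suc m) b n ≡ (cycleFactor t j b ⋆ cycleSeries t (suc j) m b) n
  cycleSeries-suc t j m b n = begin
    cycleSeries t j (suc m) b n
      ≡⟨ ∑ₗ-concatMap (λ x → map (x ∷_) V) (upTo (suc b)) g ⟩
    ∑ₗ (upTo (suc b)) (λ x → ∑ₗ (map (x ∷_) V) g)
      ≡⟨ ∑ₗ-applyUpTo (λ x → x) (suc b) (λ x → ∑ₗ (map (x ∷_) V) g) ⟩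
    ∑ (suc b) (λ x → ∑ₗ (map (x ∷_) V) g)
      ≡⟨ ∑-cong (suc b) (λ x _ → trans (∑ₗ-map (x ∷_) V g) (firstEntry x)) ⟩
    ∑ (suc b) (λ x → if x ℕ.* suc j <ᵇ suc n then e x * F′ (n ∸ x ℕ.* suc j) else 0ℚ)
      ≡⟨ ∑-cong (suc b) (λ x _ → ∑-delta (suc n) (x ℕ.* suc j) (λ i → e x * F′ (n ∸ i))) ⟨
    ∑ (suc b) (λ x → ∑ (suc n) (λ i → if x ℕ.* suc j ≡ᵇ i then e x * F′ (n ∸ i) else 0ℚ))
      ≡⟨ ∑-swap (suc b) (suc n) (λ x i → if x ℕ.* suc j ≡ᵇ i then e x * F′ (n ∸ i) else 0ℚ) ⟩
    ∑ (suc n) (λ i → ∑ (suc b) (λ x → if x ℕ.* suc j ≡ᵇ i then e x * F′ (n ∸ i) else 0ℚ))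
      ≡⟨ ∑-cong (suc n) (λ i _ → trans (∑-cong (suc b) (λ x _ → sym (if-*ʳ (x ℕ.* suc j ≡ᵇ i) (e x) (F′ (n ∸ i)))))
                                        (∑-*ʳ (suc b) _ (F′ (n ∸ i)))) ⟩
    (cycleFactor t j b ⋆ F′) n
      ∎
    where
    V = allVecs m b
    e = expCoeff (ι (t (suc j))) j
    F′ = cycleSeries t (suc j) m b
    g : Vec ℕ (suc m) → ℚ
    g c = if weightFrom (suc j) c ≡ᵇ n then typeWeight t j c else 0ℚ
    rest : Vec ℕ m → ℚ
    rest c = typeWeight t (suc j) c
    w : Vec ℕ m → ℕ
    w c = weightFrom (suc (suc j)) c
    -- the multiplicity x of (j+1)-cycles uses up (j+1)·x of the total weight n
    firstEntry : ∀ x → ∑ₗ V (λ c → g (x ∷ c)) ≡ (if x ℕ.* suc j <ᵇ suc n then e x * F′ (n ∸ x ℕ.* suc j) else 0ℚ)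
    firstEntry x = begin
      ∑ₗ V (λ c → g (x ∷ c))
        ≡⟨ ∑ₗ-cong V (λ c → trans (cong (λ a′ → if a′ ℕ.+ w c ≡ᵇ n then e x * rest c else 0ℚ) (ℕ.*-comm (suc j) x))
                                   (≡ᵇ-+-split a (w c) n (e x * rest c))) ⟩
      ∑ₗ V (λ c → if a <ᵇ suc n then (if w c ≡ᵇ n ∸ a then e x * rest c else 0ℚ) else 0ℚ)
        ≡⟨ ∑ₗ-if V (a <ᵇ suc n) _ ⟩
      (if a <ᵇ suc n then ∑ₗ V (λ c → if w c ≡ᵇ n ∸ a then e x * rest c else 0ℚ) else 0ℚ)
        ≡⟨ cong (if a <ᵇ suc n then_else 0ℚ) (trans (∑ₗ-cong V (λ c → sym (if-*ˡ _ (e x) (rest c)))) (∑ₗ-*ˡ V (e x) _)) ⟩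
      (if a <ᵇ suc n then e x * F′ (n ∸ a) else 0ℚ)
        ∎
      where a = x ℕ.* suc j

  single : ℕ → ℚ → Series
  single a v i = if a ≡ᵇ i then v else 0ℚ

  cycleFactor-expRec : ∀ t j b n → n ℕ.≤ b → ExpRec (single (suc j) (ι (t (suc j)))) (cycleFactor t j b) n
  cycleFactor-expRec t j b n n≤b = trans θfactor≡shifted (sym recurrence≡shifted)
    where
    τ = ι (t (suc j))
    e = expCoeff τ j
    -- both sides of the recurrence equal this sum: the terms of θ (cycleFactor t j b), one multiplicity lower
    shifted : ℕ → ℚ
    shifted x = if suc x ℕ.* suc j ≡ᵇ n then τ * e x else 0ℚ

    θfactor≡shifted : ι n * cycleFactor t j b n ≡ ∑ (suc b) shifted
    θfactor≡shifted = begin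
      ι n * ∑ (suc b) (λ x → if x ℕ.* suc j ≡ᵇ n then e x else 0ℚ)
        ≡⟨ ∑-*ˡ (suc b) (ι n) _ ⟨
      ∑ (suc b) (λ x → ι n * (if x ℕ.* suc j ≡ᵇ n then e x else 0ℚ))
        ≡⟨ ∑-head b _ ⟩
      ι n * (if 0 ≡ᵇ n then 1ℚ else 0ℚ) + ∑ b (λ x → ι n * (if suc x ℕ.* suc j ≡ᵇ n then e (suc x) else 0ℚ))
        ≡⟨ cong₂ _+_ (noConstantTerm n) (∑-cong b (λ x _ → lowerDegree x)) ⟩
      0ℚ + ∑ b shifted
        ≡⟨ trans (ℚ.+-identityˡ (∑ b shifted)) (sym (ℚ.+-identityʳ (∑ b shifted))) ⟩
      ∑ b shifted + 0ℚ
        ≡⟨ cong (∑ b shifted +_) lastTermVanishes ⟨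
      ∑ (suc b) shifted
        ∎
      where
      noConstantTerm : ∀ n → ι n * (if 0 ≡ᵇ n then 1ℚ else 0ℚ) ≡ 0ℚ
      noConstantTerm zero    = ℚ.*-zeroˡ 1ℚ
      noConstantTerm (suc n) = ℚ.*-zeroʳ (ι (suc n))
      lowerDegree : ∀ x → ι n * (if suc x ℕ.* suc j ≡ᵇ n then e (suc x) else 0ℚ) ≡ shifted x
      lowerDegree x with suc x ℕ.* suc j ≡ᵇ n | ≡ᵇ-reflects (suc x ℕ.* suc j) n
      ... | true  | ofʸ refl = expCoeff-step τ j x
      ... | false | ofⁿ _    = ℚ.*-zeroʳ (ι n)
      -- (b + 1)(j + 1) > b ≥ n
      lastTermVanishes : shifted b ≡ 0ℚ
      lastTermVanishes = cong (if_then τ * e b else 0ℚ) (≡ᵇ-false (λ eq → ℕ.<⇒≱ (s≤s n≤b)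
        (ℕ.≤-trans (ℕ.m≤m*n (suc b) (suc j)) (ℕ.≤-reflexive eq))))

    recurrence≡shifted : ∑ n (λ i → single (suc j) τ (suc i) * cycleFactor t j b (n ∸ suc i)) ≡ ∑ (suc b) shifted
    recurrence≡shifted = begin
      ∑ n (λ i → single (suc j) τ (suc i) * cycleFactor t j b (n ∸ suc i))
        ≡⟨ ∑-cong n (λ i _ → if-*ʳ (j ≡ᵇ i) τ _) ⟩
      ∑ n (λ i → if j ≡ᵇ i then τ * cycleFactor t j b (n ∸ suc i) else 0ℚ)
        ≡⟨ ∑-delta n j (λ i → τ * cycleFactor t j b (n ∸ suc i)) ⟩
      (if j <ᵇ n then τ * cycleFactor t j b (n ∸ suc j) else 0ℚ)
        ≡⟨ cong (if j <ᵇ n then_else 0ℚ)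
             (trans (∑-cong (suc b) (λ x _ → sym (if-*ˡ _ τ (e x)))) (∑-*ˡ (suc b) τ _)) ⟨
      (if j <ᵇ n then ∑ (suc b) (λ x → if x ℕ.* suc j ≡ᵇ n ∸ suc j then τ * e x else 0ℚ) else 0ℚ)
        ≡⟨ ∑-if (suc b) (j <ᵇ n) _ ⟨
      ∑ (suc b) (λ x → if j <ᵇ n then (if x ℕ.* suc j ≡ᵇ n ∸ suc j then τ * e x else 0ℚ) else 0ℚ)
        ≡⟨ ∑-cong (suc b) (λ x _ → ≡ᵇ-+-split (suc j) (x ℕ.* suc j) n (τ * e x)) ⟨
      ∑ (suc b) shifted
        ∎

  above : (ℕ → ℕ) → ℕ → Series
  above t j i = if j <ᵇ i then ι (t i) else 0ℚ

  above-split : ∀ t j i → single (suc j) (ι (t (suc j))) i + above t (suc j) i ≡ above t j i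
  above-split t j i with ℕ.<-cmp (suc j) i
  ... | tri< j+1<i j+1≢i _ rewrite ≡ᵇ-false j+1≢i | <ᵇ-true j+1<i | <ᵇ-true (ℕ.<-trans (ℕ.n<1+n j) j+1<i) =
    ℚ.+-identityˡ (ι (t i))
  ... | tri≈ _ refl _ rewrite ≡ᵇ-true (refl {x = suc j}) | <ᵇ-false (ℕ.n≮n (suc j)) | <ᵇ-true (ℕ.n<1+n j) =
    ℚ.+-identityʳ (ι (t (suc j)))
  ... | tri> _ j+1≢i i<j+1 rewrite ≡ᵇ-false j+1≢i | <ᵇ-false (ℕ.<⇒≯ i<j+1) | <ᵇ-false (ℕ.≤⇒≯ (ℕ.≤-pred i<j+1)) =
    ℚ.+-identityˡ 0ℚ

  cycleSeries-expRec : ∀ t m j b n → n ℕ.≤ b → n ℕ.≤ j ℕ.+ m → ExpRec (above t j) (cycleSeries t j m b) n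
  cycleSeries-expRec t zero j b n _ n≤j+0 = expRec-weights (λ _ → 0ℚ) (above t j) (cycleSeries t j 0 b) n noWeights constantRec
    where
    -- with no cycle lengths allowed the series is the constant 1
    constantθ : ∀ n → θ (cycleSeries t j 0 b) n ≡ 0ℚ
    constantθ zero    = ℚ.*-zeroˡ (1ℚ + 0ℚ)
    constantθ (suc n) = trans (cong (ι (suc n) *_) (ℚ.+-identityˡ 0ℚ)) (ℚ.*-zeroʳ (ι (suc n)))
    constantRec : ExpRec (λ _ → 0ℚ) (cycleSeries t j 0 b) n
    constantRec = trans (constantθ n) (sym (∑-zero n (λ i _ → ℚ.*-zeroˡ (cycleSeries t j 0 b (n ∸ suc i)))))
    noWeights : ∀ i → i ℕ.< n → 0ℚ ≡ above t j (suc i)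
    noWeights i i<n = cong (if_then ι (t (suc i)) else 0ℚ)
      (sym (<ᵇ-false (ℕ.≤⇒≯ (ℕ.≤-trans i<n (ℕ.≤-trans n≤j+0 (ℕ.≤-reflexive (ℕ.+-identityʳ j)))))))
  cycleSeries-expRec t (suc m) j b n n≤b n≤j+m+1 =
    expRec-series (above t j) (factor ⋆ rest) (cycleSeries t j (suc m) b) n (λ i _ → sym (cycleSeries-suc t j m b i))
      (expRec-weights (λ i → firstLength i + above t (suc j) i) (above t j) (factor ⋆ rest) n
        (λ i _ → above-split t j (suc i))
        (expRec-⋆ firstLength (above t (suc j)) factor rest n factorRec restRec))
    where
    factor = cycleFactor t j b
    rest = cycleSeries t (suc j) m b
    firstLength = single (suc j) (ι (t (suc j)))
    factorRec : ∀ i → i ℕ.≤ n → ExpRec firstLength factor i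
    factorRec i i≤n = cycleFactor-expRec t j b i (ℕ.≤-trans i≤n n≤b)
    restRec : ∀ i → i ℕ.≤ n → ExpRec (above t (suc j)) rest i
    restRec i i≤n = cycleSeries-expRec t m (suc j) b i (ℕ.≤-trans i≤n n≤b)
                      (ℕ.≤-trans i≤n (ℕ.≤-trans n≤j+m+1 (ℕ.≤-reflexive (ℕ.+-suc j m))))

  -- The constant term is 1: only the zero vector has weight 0.
  cycleSeries-zero : ∀ t j m b → cycleSeries t j m b 0 ≡ 1ℚ
  cycleSeries-zero t j zero    b = ℚ.+-identityʳ 1ℚ
  cycleSeries-zero t j (suc m) b = begin
    cycleSeries t j (suc m) b 0                                   ≡⟨ cycleSeries-suc t j m b 0 ⟩
    0ℚ + cycleFactor t j b 0 * cycleSeries t (suc j) m b 0        ≡⟨ ℚ.+-identityˡ _ ⟩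
    cycleFactor t j b 0 * cycleSeries t (suc j) m b 0             ≡⟨ cong₂ _*_ factorAtZero (cycleSeries-zero t (suc j) m b) ⟩
    1ℚ * 1ℚ                                                       ≡⟨ ℚ.*-identityˡ 1ℚ ⟩
    1ℚ                                                            ∎
    where
    factorAtZero : cycleFactor t j b 0 ≡ 1ℚ
    factorAtZero = trans (∑-head b _) (trans (cong (1ℚ +_) (∑-zero b (λ _ _ → refl))) (ℚ.+-identityʳ 1ℚ))

  -- C_k(t) ≤ k! · [Xᵏ] cycleSeries t 0 k k, since N(c) = ⌊k! / Π i^(c_i) c_i!⌋.
  cycleIndex≤ : ∀ k t → ι (C k t) ≤ ι (k !) * cycleSeries t 0 k k k
  cycleIndex≤ k t = ℚ.≤-trans (bound (allVecs k k)) (ℚ.≤-reflexive (∑ₗ-*ˡ (allVecs k k) (ι (k !)) _))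
    where
    term : Vec ℕ k → ℕ
    term c = N c ℕ.* monoFrom t 1 c
    termBound : ∀ c → ι (term c) ≤ ι (k !) * typeWeight t 0 c
    termBound c = ≤.begin
      ι (N c ℕ.* monoFrom t 1 c)     ≤.≡⟨ ι-* (N c) _ ⟩
      ι (N c) * ι (monoFrom t 1 c)   ≤.≡⟨ cong (ι (N c) *_) (typeWeight-clear t 0 c) ⟨
      ι (N c) * (ι D * w)            ≤.≡⟨ ℚ.*-assoc (ι (N c)) (ι D) w ⟨
      (ι (N c) * ι D) * w            ≤.≡⟨ cong (_* w) (ι-* (N c) D) ⟨
      ι (N c ℕ.* D) * w              ≤.≤⟨ ℚ.*-monoʳ-≤-nonNeg w {{ℚ.nonNegative (typeWeight-nonneg t 0 c)}} N·D≤k! ⟩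
      ι (k !) * w                    ≤.∎
      where
      D = denomFrom 0 c
      w = typeWeight t 0 c
      N·D≤k! : ι (N c ℕ.* D) ≤ ι (k !)
      N·D≤k! = ι-mono (m/n*n≤m (k !) D {{denomFrom-nonZero 0 c}})
    scaled : Vec ℕ k → ℚ
    scaled c = ι (k !) * (if weightFrom 1 c ≡ᵇ k then typeWeight t 0 c else 0ℚ)
    bound : ∀ L → ι (sum (map term (filter (λ c → weightFrom 1 c ℕ.≟ k) L))) ≤ ∑ₗ L scaled
    bound []      = ℚ.≤-refl
    bound (c ∷ L) with weightFrom 1 c ≡ᵇ k
    ... | true  = ℚ.≤-trans (ℚ.≤-reflexive (ι-+ (term c) _)) (ℚ.+-mono-≤ (termBound c) (bound L))
    ... | false = ℚ.≤-trans (bound L)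
      (ℚ.≤-reflexive (sym (trans (cong (_+ ∑ₗ L scaled) (ℚ.*-zeroʳ (ι (k !)))) (ℚ.+-identityˡ (∑ₗ L scaled)))))

  tSeq-split : ∀ s d m q .{{_ : ℕ.NonZero d}} → q ≡ s ℕ.+ m ℕ.* d → ∀ i → ι (tSeq s d q i) ≡ ι s + Dilated.weight d m i
  tSeq-split s d m q q≡s+md i with d ∣? i
  ... | yes _ = trans (cong ι q≡s+md) (ι-+ s (m ℕ.* d))
  ... | no  _ = sym (ℚ.+-identityʳ (ι s))

  -- The theorem for s = s′ + 1 and q = s + m d: the cycle-index series of t is
  -- (1 − X)^(−s) (1 − X^d)^(−m), which is coefficientwise at most (1 − X)^(−(s+m)).
  cycleIndex-bound : ∀ s′ d m q k .{{_ : ℕ.NonZero d}} → q ≡ suc s′ ℕ.+ m ℕ.* d →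
                     C k (tSeq (suc s′) d q) ℕ.≤ fallingFactorial (s′ ℕ.+ k ℕ.+ m) k
  cycleIndex-bound s′ d m q k q≡s+md = ι-reflect (≤.begin
    ι (C k t)                                  ≤.≤⟨ cycleIndex≤ k t ⟩
    ι (k !) * cycles k                         ≤.≡⟨ cong (ι (k !) *_) cycles≡model ⟩
    ι (k !) * model k                          ≤.≤⟨ ℚ.*-monoˡ-≤-nonNeg (ι (k !)) {{ℚ.nonNegative (ι-nonneg (k !))}} model≤negBinom ⟩
    ι (k !) * (negBinom s ⋆ negBinom m) k      ≤.≡⟨ cong (ι (k !) *_) (negBinom-⋆ s m k) ⟩
    ι (k !) * negBinom (suc (s′ ℕ.+ m)) k      ≤.≡⟨ negBinom-factorial (s′ ℕ.+ m) k ⟩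
    ι (fallingFactorial (s′ ℕ.+ m ℕ.+ k) k)    ≤.≡⟨ cong (λ x → ι (fallingFactorial x k)) (+-rightComm s′ m k) ⟩
    ι (fallingFactorial (s′ ℕ.+ k ℕ.+ m) k)    ≤.∎)
    where
    open Dilated d m
    s = suc s′
    t = tSeq s d q
    tℚ : Series
    tℚ i = ι (t i)
    cycles = cycleSeries t 0 k k
    model = negBinom s ⋆ dilated
    cyclesRec : ∀ n → n ℕ.≤ k → ExpRec tℚ cycles n
    cyclesRec n n≤k = expRec-weights (above t 0) tℚ cycles n (λ _ _ → refl) (cycleSeries-expRec t k 0 k n n≤k n≤k)
    modelRec : ∀ n → n ℕ.≤ k → ExpRec tℚ model n
    modelRec n _ = expRec-weights (λ i → ι s + weight i) tℚ model n (λ i _ → sym (tSeq-split s d m q q≡s+md (suc i)))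
      (expRec-⋆ (λ _ → ι s) weight (negBinom s) dilated n (λ i _ → negBinom-expRec s i) (λ i _ → dilated-expRec i))
    cycles≡model : cycles k ≡ model k
    cycles≡model = expRec-unique k tℚ cycles model cyclesRec modelRec
      (trans (cycleSeries-zero t 0 k k) (sym (trans (ℚ.+-identityˡ _) (trans (cong (1ℚ *_) (dilated-∣ 0)) (ℚ.*-identityˡ 1ℚ)))))
      k ℕ.≤-refl
    model≤negBinom : model k ≤ (negBinom s ⋆ negBinom m) k
    model≤negBinom = ⋆-monoʳ k (λ i _ → negBinom-nonneg s i) (λ i _ → dilated≤negBinom i)

open import Defs
open import Data.Nat using (ℕ; _+_; _∸_; _≤_; NonZero)
open import Data.Nat.DivMod using (_/_)
open import Data.Nat.Divisibility using (_∣_)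
open import Data.Nat using (zero; suc; _*_)
open import Data.Nat.Properties using (m+[n∸m]≡n)
open import Data.Nat.DivMod using (m/n*n≡m)
open import Relation.Binary.PropositionalEquality using (_≡_; cong; sym; trans)
open GeneratingSeries using (cycleIndex-bound)

corollary2p5 : (s d k q : ℕ) → .{{_ : NonZero d}} → 1 ≤ s → 1 ≤ k → 1 ≤ q → s ≤ q → d ∣ (q ∸ s) →
    C k (tSeq s d q) ≤ fallingFactorial (s + k + (q ∸ s) / d ∸ 1) k
corollary2p5 zero     d k q () _ _ _ _
corollary2p5 (suc s′) d k q _ _ _ s≤q d∣q∸s = cycleIndex-bound s′ d ((q ∸ suc s′) / d) q k q≡s+md
  where
  -- d divides q − s, so q = s + ((q − s) / d) · d
  q≡s+md : q ≡ suc s′ + (q ∸ suc s′) / d * d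
  q≡s+md = trans (sym (m+[n∸m]≡n s≤q)) (cong (suc s′ +_) (sym (m/n*n≡m d∣q∸s)))
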